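{- Let $q$ be a prime power and let $\mathcal V=\{V_1,\dots,V_k\}$ be a collection of subspaces of $GF(q)^n$. Then the array $OA(\mathcal V)$ is an orthogonal array of strength $t$ if and only if $\mathcal V$ is a mixed spread of strength $t$.
   Context: A collection $\mathcal V=\{V_1,\dots,V_k\}$ of subspaces of $GF(q)^n$ is a mixed spread of strength $t$ if for every choice of $\tau\le t$ indices $1\le i_1<\cdots<i_\tau\le k$ the dimension (over $GF(q)$) of the span of $V_{i_1},\dots,V_{i_\tau}$ equals $\dim V_{i_1}+\cdots+\dim V_{i_\tau}$. For each $i$, fix a labeling $f_0,f_1,\dots,f_{q^{\dim V_i}-1}$ of the dual space $V_i^*$ of linear functionals on $V_i$. The array $OA(\mathcal V)$ has $q^n$ rows indexed by the linear functionals $f$ on $GF(q)^n$ and $k$ columns indexed by $V_1,\dots,V_k$; its $(f,V_i)$ entry is $j$ where $f|_{V_i}$ is the $j$-th functional in the labeling of $V_i^*$; so column $i$ has symbols from $\{0,\dots,q^{\dim V_i}-1\}$. An $N\times k$ array whose $i$-th column has symbols from a set of size $s_i$ is an orthogonal array of strength $t$ if in every $N\times t$ subarray every possible $t$-tuple of symbols occurs equally often as a row. -}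

module Defs where

open import Level using (0ℓ)
open import Algebra.Core using (Op₁; Op₂)
open import Algebra.Structures using (IsCommutativeRing)
open import Data.Nat as ℕ using (ℕ; zero; suc; _^_; _≤_; _<_)
open import Data.Nat.Primality using (Prime)
open import Data.Fin as Fin using (Fin)
open import Data.Vec as Vec using (Vec; zipWith; replicate; tabulate)
open import Data.List using (List; length)
open import Data.List.Relation.Unary.All using (All)
open import Data.List.Relation.Unary.Unique.Propositional using (Unique)
open import Data.List.Membership.Propositional using (_∈_)
open import Data.Product using (Σ; ∃; ∃₂; _×_)
open import Function using (_∘_)
open import Function.Bundles using (_↔_)
open import Relation.Binary.PropositionalEquality using (_≡_; _≢_)

IsPrimePower : ℕ → Set
IsPrimePower q = ∃₂ λ p m → Prime p × 1 ≤ m × q ≡ p ^ m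

-- A finite field with exactly q elements (i.e. GF(q), unique up to isomorphism).
record FiniteField (q : ℕ) : Set₁ where
  field
    Carrier           : Set
    _+_ _*_           : Op₂ Carrier
    -_                : Op₁ Carrier
    0# 1#             : Carrier
    isCommutativeRing : IsCommutativeRing _≡_ _+_ _*_ -_ 0# 1#
    0≢1               : 0# ≢ 1#
    inverse           : ∀ x → x ≢ 0# → ∃ λ y → x * y ≡ 1#
    enumeration       : Fin q ↔ Carrier

sumℕ : ∀ {τ} → (Fin τ → ℕ) → ℕ
sumℕ f = Vec.sum (tabulate f)

StrictlyIncreasing : ∀ {τ k} → (Fin τ → Fin k) → Set
StrictlyIncreasing {τ} i = ∀ (a b : Fin τ) → a Fin.< b → i a Fin.< i b

module _ {A : Set} where
  CountIs : (A → Set) → ℕ → Set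
  CountIs P m = Σ (List A) λ xs →
    Unique xs × All P xs × (∀ a → P a → a ∈ xs) × length xs ≡ m

module _ {q : ℕ} (F : FiniteField q) where
  open FiniteField F

  zeroᵥ : ∀ {n} → Vec Carrier n
  zeroᵥ {n} = replicate n 0#

  _+ᵥ_ : ∀ {n} → Vec Carrier n → Vec Carrier n → Vec Carrier n
  _+ᵥ_ = zipWith _+_

  _·ᵥ_ : ∀ {n} → Carrier → Vec Carrier n → Vec Carrier n
  c ·ᵥ v = Vec.map (c *_) v

  -- standard dot product: a linear functional on GF(q)^n is x ↦ a · x
  dot : ∀ {n} → Vec Carrier n → Vec Carrier n → Carrier
  dot a v = Vec.foldr _ _+_ 0# (zipWith _*_ a v)

  sumᵥ : ∀ {n d} → (Fin d → Vec Carrier n) → Vec Carrier n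
  sumᵥ {d = zero}  u = zeroᵥ
  sumᵥ {d = suc d} u = u Fin.zero +ᵥ sumᵥ (u ∘ Fin.suc)

  linComb : ∀ {n d} → (Fin d → Vec Carrier n) → (Fin d → Carrier) → Vec Carrier n
  linComb b c = sumᵥ (λ j → c j ·ᵥ b j)

  InSpan : ∀ {n d} → (Fin d → Vec Carrier n) → Vec Carrier n → Set
  InSpan b v = ∃ λ c → v ≡ linComb b c

  LinIndep : ∀ {n d} → (Fin d → Vec Carrier n) → Set
  LinIndep b = ∀ c → linComb b c ≡ zeroᵥ → ∀ j → c j ≡ 0#

  HasDim : ∀ {n} → (Vec Carrier n → Set) → ℕ → Set
  HasDim {n} P d = Σ (Fin d → Vec Carrier n) λ b →
    (∀ j → P (b j)) × LinIndep b × (∀ v → P v → InSpan b v)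

  record Subspace (n : ℕ) : Set₁ where
    field
      mem      : Vec Carrier n → Set
      zero-mem : mem zeroᵥ
      add-mem  : ∀ u v → mem u → mem v → mem (u +ᵥ v)
      scal-mem : ∀ c v → mem v → mem (c ·ᵥ v)
      dim      : ℕ
      hasDim   : HasDim mem dim
  open Subspace public

  SpanOf : ∀ {n τ} → (Fin τ → Subspace n) → Vec Carrier n → Set
  SpanOf W v = ∃ λ u → (∀ j → mem (W j) (u j)) × v ≡ sumᵥ u

  MixedSpread : ∀ {n k} → (Fin k → Subspace n) → ℕ → Set
  MixedSpread {k = k} V t = ∀ τ → τ ≤ t → (i : Fin τ → Fin k) → StrictlyIncreasing i →
    HasDim (SpanOf (V ∘ i)) (sumℕ (λ j → dim (V (i j))))

  record Dual {n} (V : Subspace n) : Set where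
    field
      app      : ∀ v → mem V v → Carrier
      additive : ∀ u v pu pv puv → app (u +ᵥ v) puv ≡ app u pu + app v pv
      homog    : ∀ c u pu pcu → app (c ·ᵥ u) pcu ≡ c * app u pu
  open Dual public

  _≈*_ : ∀ {n} {V : Subspace n} → Dual V → Dual V → Set
  f ≈* g = ∀ v p → app f v p ≡ app g v p

  record Labeling {n} (V : Subspace n) : Set where
    field
      fn   : Fin (q ^ dim V) → Dual V
      inj  : ∀ i j → fn i ≈* fn j → i ≡ j
      surj : ∀ g → ∃ λ j → fn j ≈* g
  open Labeling public

  -- The row indexed by the functional x ↦ a·x has entry j in column V
  -- iff its restriction to V is the j-th functional of the labeling.
  EntryIs : ∀ {n} {V : Subspace n} → Labeling V → Vec Carrier n → Fin (q ^ dim V) → Set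
  EntryIs {V = V} L a j = ∀ v (p : mem V v) → app (fn L j) v p ≡ dot a v

  IsOAofStrength : ∀ {n k} (V : Fin k → Subspace n) → ((i : Fin k) → Labeling (V i)) → ℕ → Set
  IsOAofStrength {n} {k} V L t = (i : Fin t → Fin k) → StrictlyIncreasing i →
    ∃ λ λ′ → (js : (s : Fin t) → Fin (q ^ dim (V (i s)))) →
      CountIs (λ (a : Vec Carrier n) → ∀ s → EntryIs (L (i s)) a (js s)) λ′

module Submission where

-- A row of OA(𝒱) is a vector a ∈ GF(q)ⁿ; its entry in column V is the restriction of x ↦ a·x
-- to V.  Concatenating bases of chosen columns V_{i₁}, …, V_{i_τ} into one family C, the rows
-- with prescribed entries in these columns are the solutions a of a linear system a·C_m = T_m.
-- If 𝒱 is a mixed spread, C is linearly independent, so (by Gaussian elimination) every such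
-- system is solvable and its solution set is a translate of the kernel: all symbol tuples occur
-- equally often.  Conversely, let OA(𝒱) have strength t and τ ≤ t.  Extending the τ columns to
-- t columns, the all-zero tuple occurs (in the zero row), so every tuple occurs.  Given
-- u₁ + ⋯ + u_τ = 0 with u_s ∈ V_{i_s}, a row restricting to a coordinate functional on V_{i_s}
-- and to zero on the other columns shows that this coordinate of u_s vanishes.  So the sum of
-- the V_{i_s} is direct, and the concatenated bases form a basis of their span.

open import Defs hiding (zeroᵥ; _+ᵥ_; _·ᵥ_; dot; sumᵥ; linComb)
import Defs as D
open import Data.Nat using (ℕ; _≤_)
open import Data.Fin using (Fin)
open import Function.Bundles using (_⇔_)

open import Data.Nat as ℕ using (zero; suc; s≤s; _≤?_; _^_)
import Data.Nat.Properties as ℕ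
open import Data.Fin as Fin using (zero; suc; punchIn; punchOut; inject≤; _↑ˡ_; _↑ʳ_; splitAt; join)
import Data.Fin.Properties as Fin
open import Data.Vec.Functional as Vector using (Vector)
import Data.Vec.Functional.Properties as VectorP
open import Level using (0ℓ)
open import Algebra.Bundles using (CommutativeRing; CommutativeMonoid; AbelianGroup)
open import Algebra.Structures using (IsCommutativeRing; IsAbelianGroup)
import Algebra.Properties.CommutativeMonoid.Sum as MonoidSum
import Algebra.Properties.Group as GroupProperties
import Algebra.Properties.CommutativeSemigroup as CommutativeSemigroupProperties
open import Data.Vec as Vec using (Vec; []; _∷_)
import Data.Vec.Properties as Vec
open import Data.Vec.Relation.Binary.Pointwise.Inductive
  using (Pointwise-≡⇒≡; zipWith-assoc; zipWith-comm; zipWith-identityˡ; zipWith-identityʳ)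
open import Data.Product using (∃; _,_; proj₁; proj₂)
open import Data.Sum using (_⊎_; inj₁; inj₂; [_,_]′)
open import Data.List as List using (List)
import Data.List.Properties as List
open import Data.List.Relation.Unary.All as All using (All)
open import Data.List.Relation.Unary.Any as Any using ()
open import Data.List.Relation.Unary.AllPairs as AllPairs using ()
open import Data.List.Relation.Unary.Unique.Propositional using (Unique)
open import Data.List.Membership.Propositional using (_∈_)
import Data.List.Relation.Unary.All.Properties as All
import Data.List.Relation.Unary.Unique.Propositional.Properties as Unique
import Data.List.Membership.Propositional.Properties as Membership
open import Function.Bundles using (Injection; Inverse; Equivalence; mk⇔)
open import Function using (_∘_; id)
open import Function.Definitions using (Injective)
open import Relation.Binary using (tri<; tri≈; tri>)
import Relation.Binary.PropositionalEquality as Eq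
open Eq
  using (_≡_; _≢_; _≗_; refl; sym; trans; cong; cong₂; subst; subst₂; module ≡-Reasoning)
open import Relation.Unary using (Decidable)
open import Relation.Nullary using (¬_; Dec; yes; no; contradiction; ¬?)
open import Relation.Nullary.Decidable using (via-injection; decidable-stable)
open import Function.Properties.Inverse using (↔⇒↣; ↔-sym)

StrictlyIncreasing⇒injective : ∀ {τ k} {i : Fin τ → Fin k} → StrictlyIncreasing i → Injective _≡_ _≡_ i
StrictlyIncreasing⇒injective inc {a} {b} ia≡ib with Fin.<-cmp a b
... | tri< a<b _ _ = contradiction (cong Fin.toℕ ia≡ib) (ℕ.<⇒≢ (inc a b a<b))
... | tri≈ _ a≡b _ = a≡b
... | tri> _ _ b<a = contradiction (cong Fin.toℕ ia≡ib) (ℕ.>⇒≢ (inc b a b<a))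

record Extension {τ k} (t : ℕ) (i : Fin τ → Fin k) : Set where
  field
    indices    : Fin t → Fin k
    increasing : StrictlyIncreasing indices
    covers     : ∀ s → ∃ λ s′ → indices s′ ≡ i s

suc-increasing : ∀ {τ k} {j : Fin τ → Fin k} → StrictlyIncreasing j → StrictlyIncreasing (suc ∘ j)
suc-increasing inc a b a<b = s≤s (inc a b a<b)

zero∷suc-increasing : ∀ {τ k} {j : Fin τ → Fin k} → StrictlyIncreasing j →
                      StrictlyIncreasing {k = suc k} (zero Vector.∷ suc ∘ j)
zero∷suc-increasing inc zero    (suc b) _         = s≤s ℕ.z≤n
zero∷suc-increasing inc (suc a) (suc b) (s≤s a<b) = suc-increasing inc a b a<b

module _ {τ k : ℕ} {i : Fin τ → Fin (suc k)} (inc : StrictlyIncreasing i) (i≢0 : ∀ s → zero ≢ i s) where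

  lower : Fin τ → Fin k
  lower s = punchOut (i≢0 s)

  suc-lower : ∀ s → suc (lower s) ≡ i s
  suc-lower s = Fin.punchIn-punchOut (i≢0 s)

  lower-increasing : StrictlyIncreasing lower
  lower-increasing a b a<b =
    ℕ.s<s⁻¹ (subst₂ Fin._<_ (sym (suc-lower a)) (sym (suc-lower b)) (inc a b a<b))

increasing-suc≢0 : ∀ {τ k} {i : Fin (suc τ) → Fin (suc k)} → StrictlyIncreasing i → ∀ s → zero ≢ i (suc s)
increasing-suc≢0 {i = i} inc s 0≡i =
  ℕ.n≮0 (subst (λ x → Fin.toℕ (i zero) ℕ.< Fin.toℕ x) (sym 0≡i) (inc zero (suc s) (s≤s ℕ.z≤n)))

inject≤-increasing : ∀ {t k} (t≤k : t ≤ k) → StrictlyIncreasing (λ (s : Fin t) → inject≤ s t≤k)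
inject≤-increasing t≤k a b a<b =
  subst₂ ℕ._<_ (sym (Fin.toℕ-inject≤ a t≤k)) (sym (Fin.toℕ-inject≤ b t≤k)) a<b

-- Column 0 is either among the chosen columns (keep it and recurse), or may be skipped,
-- or else t = k and all columns are taken.
extend : ∀ {τ t k} {i : Fin τ → Fin k} → τ ≤ t → t ≤ k → StrictlyIncreasing i → Extension t i
extend {zero} _ t≤k _ = record
  { indices = λ s → inject≤ s t≤k ; increasing = inject≤-increasing t≤k ; covers = λ () }
extend {suc τ} {suc t} {suc k} {i} (s≤s τ≤t) (s≤s t≤k) inc with i zero Fin.≟ zero
... | yes i₀≡0 = record
  { indices = zero Vector.∷ suc ∘ indices ; increasing = zero∷suc-increasing increasing ; covers = covers′ }
  where
    inc⁺ : StrictlyIncreasing (i ∘ suc)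
    inc⁺ a b a<b = inc (suc a) (suc b) (s≤s a<b)
    i⁺≢0 : ∀ s → zero ≢ i (suc s)
    i⁺≢0 = increasing-suc≢0 inc
    open Extension (extend τ≤t t≤k (lower-increasing inc⁺ i⁺≢0))
    covers′ : ∀ s → ∃ λ s′ → (zero Vector.∷ suc ∘ indices) s′ ≡ i s
    covers′ zero    = zero , sym i₀≡0
    covers′ (suc s) = let s′ , eq = covers s in suc s′ , trans (cong suc eq) (suc-lower inc⁺ i⁺≢0 s)
... | no i₀≢0 with suc t ≤? k
...   | yes t<k = record
  { indices = suc ∘ indices ; increasing = suc-increasing increasing ; covers = covers′ }
  where
    i≢0 : ∀ s → zero ≢ i s
    i≢0 zero    = i₀≢0 ∘ sym
    i≢0 (suc s) = increasing-suc≢0 inc s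
    open Extension (extend (s≤s τ≤t) t<k (lower-increasing inc i≢0))
    covers′ : ∀ s → ∃ λ s′ → suc (indices s′) ≡ i s
    covers′ s = let s′ , eq = covers s in s′ , trans (cong suc eq) (suc-lower inc i≢0 s)
...   | no t≮k rewrite ℕ.≤-antisym t≤k (ℕ.≮⇒≥ t≮k) = record
  { indices = id ; increasing = λ _ _ → id ; covers = λ s → i s , refl }

concat : ∀ {A : Set} {τ} {d : Fin τ → ℕ} → ((s : Fin τ) → Fin (d s) → A) → Fin (sumℕ d) → A
concat {τ = suc τ} {d} b m = [ b zero , concat (b ∘ suc) ]′ (splitAt (d zero) m)

inject : ∀ {τ} {d : Fin τ → ℕ} (s : Fin τ) → Fin (d s) → Fin (sumℕ d)
inject {d = d} zero    l = l ↑ˡ sumℕ (d ∘ suc)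
inject {d = d} (suc s) l = d zero ↑ʳ inject s l

concat-↑ʳ : ∀ {A : Set} {τ} {d : Fin (suc τ) → ℕ} (b : (s : Fin (suc τ)) → Fin (d s) → A) m →
            concat b (d zero ↑ʳ m) ≡ concat (b ∘ suc) m
concat-↑ʳ {d = d} b m = cong [ b zero , concat (b ∘ suc) ]′ (Fin.splitAt-↑ʳ (d zero) _ m)

concat-inject : ∀ {A : Set} {τ} {d : Fin τ → ℕ} (b : (s : Fin τ) → Fin (d s) → A) s l →
                concat b (inject {d = d} s l) ≡ b s l
concat-inject {d = d} b zero    l = cong [ b zero , concat (b ∘ suc) ]′ (Fin.splitAt-↑ˡ (d zero) l _)
concat-inject {d = d} b (suc s) l = trans (concat-↑ʳ b (inject s l)) (concat-inject {d = d ∘ suc} (b ∘ suc) s l)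

∀-inject : ∀ {τ} {d : Fin τ → ℕ} {P : Fin (sumℕ d) → Set} → (∀ s l → P (inject {d = d} s l)) → ∀ m → P m
∀-inject {suc τ} {d} {P} P-inject m = subst P (Fin.join-splitAt (d zero) _ m) (P-join (splitAt (d zero) m))
  where
    P-join : ∀ x → P (join (d zero) _ x)
    P-join (inj₁ l) = P-inject zero l
    P-join (inj₂ m′) = ∀-inject {d = d ∘ suc} {P = P ∘ (d zero ↑ʳ_)} (P-inject ∘ suc) m′

∀-punchIn : ∀ {d} {P : Fin (suc d) → Set} i → P i → (∀ j → P (punchIn i j)) → ∀ l → P l
∀-punchIn {P = P} i Pᵢ P-punchIn l with i Fin.≟ l
... | yes refl = Pᵢ
... | no  i≢l  = subst P (Fin.punchIn-punchOut i≢l) (P-punchIn (punchOut i≢l))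

module _ (M : CommutativeMonoid 0ℓ 0ℓ) where
  open CommutativeMonoid M using (Carrier; _≈_; _∙_; ε; ∙-congˡ; identityʳ; setoid)
  open MonoidSum M using (sum; sum-remove; sum-cong-≋; sum-replicate-zero)
  open import Relation.Binary.Reasoning.Setoid setoid

  sum-single : ∀ {d} (u : Vector Carrier d) i → (∀ j → j ≢ i → u j ≈ ε) → sum u ≈ u i
  sum-single {suc d} u i u≈ε = begin
    sum u                      ≈⟨ sum-remove u ⟩
    u i ∙ sum (u ∘ Fin.punchIn i) ≈⟨ ∙-congˡ (sum-cong-≋ (λ j → u≈ε _ (Fin.punchInᵢ≢i i j))) ⟩
    u i ∙ sum {d} (λ _ → ε)    ≈⟨ ∙-congˡ (sum-replicate-zero d) ⟩
    u i ∙ ε                    ≈⟨ identityʳ (u i) ⟩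
    u i                        ∎

CountIs-resp : ∀ {A : Set} {P Q : A → Set} {m} → (∀ {a} → P a → Q a) → (∀ {a} → Q a → P a) →
               CountIs P m → CountIs Q m
CountIs-resp P⇒Q Q⇒P (xs , unique , all , complete , length) =
  xs , unique , All.map P⇒Q all , (λ a → complete a ∘ Q⇒P) , length

CountIs-witness : ∀ {A : Set} {P Q : A → Set} {m a} → CountIs P m → P a → CountIs Q m → ∃ Q
CountIs-witness (xs , _ , _ , complete , xs≡m) Pa (List.[] , _ , _ , _ , []≡m) =
  contradiction (trans xs≡m (sym []≡m)) (ℕ.n>0⇒n≢0 (Membership.∈-length (complete _ Pa)))
CountIs-witness _ _ (y List.∷ _ , _ , Qy All.∷ _ , _ , _) = y , Qy

module _ {q : ℕ} (F : FiniteField q) where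
  open FiniteField F
    renaming (Carrier to R; _+_ to infixl 6 _+_; _*_ to infixl 7 _*_; -_ to infix 8 -_)
  open IsCommutativeRing isCommutativeRing
    using ( +-assoc; +-comm; +-identityˡ; +-identityʳ; -‿inverseˡ; -‿inverseʳ
          ; *-assoc; *-comm; *-identityˡ; *-identityʳ; distribˡ; distribʳ; zeroˡ; zeroʳ)

  ring : CommutativeRing 0ℓ 0ℓ
  ring = record { isCommutativeRing = isCommutativeRing }

  open import Algebra.Properties.Ring (CommutativeRing.ring ring) using (-‿distribˡ-*)
  open import Algebra.Properties.AbelianGroup (CommutativeRing.+-abelianGroup ring) using ()
    renaming (⁻¹-∙-comm to -‿+-comm)
  open GroupProperties (CommutativeRing.+-group ring) using (x∙y⁻¹≈ε⇒x≈y; ε⁻¹≈ε; ∙-cancelʳ)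
    renaming (//-rightDividesˡ to x-y+y≡x)
  open CommutativeSemigroupProperties (CommutativeRing.*-commutativeSemigroup ring) using ()
    renaming (x∙yz≈y∙xz to x*yz≈y*xz)
  open MonoidSum (CommutativeRing.+-commutativeMonoid ring) using (sum; sum-cong-≗; sum-replicate-zero)
  open CommutativeSemigroupProperties (CommutativeRing.+-commutativeSemigroup ring) using ()
    renaming (interchange to +-interchange)

  -- Linear algebra over F

  _≟_ : (x y : R) → Dec (x ≡ y)
  _≟_ = via-injection (↔⇒↣ (↔-sym enumeration)) Fin._≟_

  infixl 6 _+ᵥ_
  infixr 7 _·ᵥ_
  infix 8 -ᵥ_

  zeroᵥ : ∀ {n} → Vec R n
  zeroᵥ = D.zeroᵥ F

  _+ᵥ_ : ∀ {n} → Vec R n → Vec R n → Vec R n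
  _+ᵥ_ = D._+ᵥ_ F

  _·ᵥ_ : ∀ {n} → R → Vec R n → Vec R n
  _·ᵥ_ = D._·ᵥ_ F

  -ᵥ_ : ∀ {n} → Vec R n → Vec R n
  -ᵥ_ = Vec.map (λ x → - x)

  -ᵥ‿inverseˡ : ∀ {n} (v : Vec R n) → -ᵥ v +ᵥ v ≡ zeroᵥ
  -ᵥ‿inverseˡ []      = refl
  -ᵥ‿inverseˡ (x ∷ v) = cong₂ _∷_ (-‿inverseˡ x) (-ᵥ‿inverseˡ v)

  -ᵥ‿inverseʳ : ∀ {n} (v : Vec R n) → v +ᵥ -ᵥ v ≡ zeroᵥ
  -ᵥ‿inverseʳ []      = refl
  -ᵥ‿inverseʳ (x ∷ v) = cong₂ _∷_ (-‿inverseʳ x) (-ᵥ‿inverseʳ v)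

  +ᵥ-isAbelianGroup : ∀ n → IsAbelianGroup (_≡_ {A = Vec R n}) _+ᵥ_ zeroᵥ -ᵥ_
  +ᵥ-isAbelianGroup n = record
    { isGroup = record
      { isMonoid = record
        { isSemigroup = record
          { isMagma = record { isEquivalence = Eq.isEquivalence ; ∙-cong = cong₂ _+ᵥ_ }
          ; assoc   = λ u v w → Pointwise-≡⇒≡ (zipWith-assoc +-assoc u v w) }
        ; identity = (λ v → Pointwise-≡⇒≡ (zipWith-identityˡ +-identityˡ v))
                   , (λ v → Pointwise-≡⇒≡ (zipWith-identityʳ +-identityʳ v)) }
      ; inverse = -ᵥ‿inverseˡ , -ᵥ‿inverseʳ
      ; ⁻¹-cong = cong -ᵥ_ }
    ; comm = λ u v → Pointwise-≡⇒≡ (zipWith-comm +-comm u v) }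

  +ᵥ-abelianGroup : ℕ → AbelianGroup 0ℓ 0ℓ
  +ᵥ-abelianGroup n = record { isAbelianGroup = +ᵥ-isAbelianGroup n }

  module _ {n : ℕ} where
    open IsAbelianGroup (+ᵥ-isAbelianGroup n) public
      using () renaming (assoc to +ᵥ-assoc; comm to +ᵥ-comm; identityˡ to +ᵥ-identityˡ; identityʳ to +ᵥ-identityʳ)
    open GroupProperties (AbelianGroup.group (+ᵥ-abelianGroup n)) public
      using () renaming (∙-cancelˡ to +ᵥ-cancelˡ; ∙-cancelʳ to +ᵥ-cancelʳ)
    open CommutativeSemigroupProperties (AbelianGroup.commutativeSemigroup (+ᵥ-abelianGroup n)) public
      using () renaming (interchange to +ᵥ-interchange)
    open MonoidSum (AbelianGroup.commutativeMonoid (+ᵥ-abelianGroup n)) public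
      using () renaming (sum to ∑ᵥ; sum-remove to ∑ᵥ-remove)

  ·ᵥ-distribˡ : ∀ {n} c (u v : Vec R n) → c ·ᵥ (u +ᵥ v) ≡ c ·ᵥ u +ᵥ c ·ᵥ v
  ·ᵥ-distribˡ c []      []      = refl
  ·ᵥ-distribˡ c (x ∷ u) (y ∷ v) = cong₂ _∷_ (distribˡ c x y) (·ᵥ-distribˡ c u v)

  ·ᵥ-distribʳ : ∀ {n} c d (u : Vec R n) → (c + d) ·ᵥ u ≡ c ·ᵥ u +ᵥ d ·ᵥ u
  ·ᵥ-distribʳ c d []      = refl
  ·ᵥ-distribʳ c d (x ∷ u) = cong₂ _∷_ (distribʳ x c d) (·ᵥ-distribʳ c d u)

  ·ᵥ-assoc : ∀ {n} c d (u : Vec R n) → (c * d) ·ᵥ u ≡ c ·ᵥ d ·ᵥ u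
  ·ᵥ-assoc c d []      = refl
  ·ᵥ-assoc c d (x ∷ u) = cong₂ _∷_ (*-assoc c d x) (·ᵥ-assoc c d u)

  ·ᵥ-zeroˡ : ∀ {n} (u : Vec R n) → 0# ·ᵥ u ≡ zeroᵥ
  ·ᵥ-zeroˡ []      = refl
  ·ᵥ-zeroˡ (x ∷ u) = cong₂ _∷_ (zeroˡ x) (·ᵥ-zeroˡ u)

  ·ᵥ-zeroʳ : ∀ {n} c → c ·ᵥ zeroᵥ {n} ≡ zeroᵥ
  ·ᵥ-zeroʳ {zero}  c = refl
  ·ᵥ-zeroʳ {suc n} c = cong₂ _∷_ (zeroʳ c) (·ᵥ-zeroʳ c)

  sumᵥ : ∀ {n d} → (Fin d → Vec R n) → Vec R n
  sumᵥ = D.sumᵥ F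

  sumᵥ≡∑ᵥ : ∀ {n d} (u : Fin d → Vec R n) → sumᵥ u ≡ ∑ᵥ u
  sumᵥ≡∑ᵥ {d = zero}  u = refl
  sumᵥ≡∑ᵥ {d = suc d} u = cong (u zero +ᵥ_) (sumᵥ≡∑ᵥ (u ∘ suc))

  sumᵥ-cong : ∀ {n d} {u u′ : Fin d → Vec R n} → u ≗ u′ → sumᵥ u ≡ sumᵥ u′
  sumᵥ-cong {d = zero}  u≗u′ = refl
  sumᵥ-cong {d = suc d} u≗u′ = cong₂ _+ᵥ_ (u≗u′ zero) (sumᵥ-cong (u≗u′ ∘ suc))

  linComb : ∀ {n d} → (Fin d → Vec R n) → (Fin d → R) → Vec R n
  linComb = D.linComb F

  linComb-cong : ∀ {n d} (b : Fin d → Vec R n) {c c′} → c ≗ c′ → linComb b c ≡ linComb b c′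
  linComb-cong {d = zero}  b c≗c′ = refl
  linComb-cong {d = suc d} b c≗c′ = cong₂ _+ᵥ_ (cong (_·ᵥ b zero) (c≗c′ zero)) (linComb-cong (b ∘ suc) (c≗c′ ∘ suc))

  linComb-congˡ : ∀ {n d} {b b′ : Fin d → Vec R n} → b ≗ b′ → ∀ c → linComb b c ≡ linComb b′ c
  linComb-congˡ {d = zero}  b≗b′ c = refl
  linComb-congˡ {d = suc d} b≗b′ c = cong₂ _+ᵥ_ (cong (c zero ·ᵥ_) (b≗b′ zero)) (linComb-congˡ (b≗b′ ∘ suc) (c ∘ suc))

  linComb-+ : ∀ {n d} (b : Fin d → Vec R n) c c′ → linComb b (λ j → c j + c′ j) ≡ linComb b c +ᵥ linComb b c′
  linComb-+ {d = zero}  b c c′ = sym (+ᵥ-identityˡ zeroᵥ)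
  linComb-+ {d = suc d} b c c′ = begin
    (c zero + c′ zero) ·ᵥ b zero +ᵥ linComb (b ∘ suc) (λ j → c (suc j) + c′ (suc j))
      ≡⟨ cong₂ _+ᵥ_ (·ᵥ-distribʳ (c zero) (c′ zero) (b zero)) (linComb-+ (b ∘ suc) (c ∘ suc) (c′ ∘ suc)) ⟩
    (c zero ·ᵥ b zero +ᵥ c′ zero ·ᵥ b zero) +ᵥ (linComb (b ∘ suc) (c ∘ suc) +ᵥ linComb (b ∘ suc) (c′ ∘ suc))
      ≡⟨ +ᵥ-interchange _ _ _ _ ⟩
    linComb b c +ᵥ linComb b c′ ∎
    where open ≡-Reasoning

  linComb-* : ∀ {n d} (b : Fin d → Vec R n) x c → linComb b (λ j → x * c j) ≡ x ·ᵥ linComb b c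
  linComb-* {d = zero}  b x c = sym (·ᵥ-zeroʳ x)
  linComb-* {d = suc d} b x c =
    trans (cong₂ _+ᵥ_ (·ᵥ-assoc x (c zero) (b zero)) (linComb-* (b ∘ suc) x (c ∘ suc)))
          (sym (·ᵥ-distribˡ x _ _))

  linComb-zero : ∀ {n d} (b : Fin d → Vec R n) → linComb b (λ _ → 0#) ≡ zeroᵥ
  linComb-zero {d = zero}  b = refl
  linComb-zero {d = suc d} b = trans (cong₂ _+ᵥ_ (·ᵥ-zeroˡ (b zero)) (linComb-zero (b ∘ suc))) (+ᵥ-identityˡ zeroᵥ)

  linComb-zeroᵥ : ∀ {n d} (c : Fin d → R) → linComb (λ _ → zeroᵥ {n}) c ≡ zeroᵥ
  linComb-zeroᵥ {d = zero}  c = refl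
  linComb-zeroᵥ {d = suc d} c = trans (cong₂ _+ᵥ_ (·ᵥ-zeroʳ (c zero)) (linComb-zeroᵥ (c ∘ suc))) (+ᵥ-identityˡ zeroᵥ)

  linComb-remove : ∀ {n d} (b : Fin (suc d) → Vec R n) c i →
                   linComb b c ≡ c i ·ᵥ b i +ᵥ linComb (b ∘ punchIn i) (c ∘ punchIn i)
  linComb-remove b c i = begin
    linComb b c                                           ≡⟨ sumᵥ≡∑ᵥ u ⟩
    ∑ᵥ u                                                  ≡⟨ ∑ᵥ-remove {i = i} u ⟩
    u i +ᵥ ∑ᵥ (u ∘ punchIn i)                             ≡⟨ cong (u i +ᵥ_) (sym (sumᵥ≡∑ᵥ (u ∘ punchIn i))) ⟩
    c i ·ᵥ b i +ᵥ linComb (b ∘ punchIn i) (c ∘ punchIn i) ∎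
    where
      open ≡-Reasoning
      u : Fin _ → Vec R _
      u j = c j ·ᵥ b j

  linComb-++ : ∀ {n} d {d′} (b : Fin (d ℕ.+ d′) → Vec R n) c →
               linComb b c ≡ linComb (λ j → b (j ↑ˡ d′)) (λ j → c (j ↑ˡ d′))
                             +ᵥ linComb (λ j → b (d ↑ʳ j)) (λ j → c (d ↑ʳ j))
  linComb-++ zero    b c = sym (+ᵥ-identityˡ _)
  linComb-++ (suc d) b c = trans (cong (c zero ·ᵥ b zero +ᵥ_) (linComb-++ d (b ∘ suc) (c ∘ suc))) (sym (+ᵥ-assoc _ _ _))

  linComb-∷ : ∀ {n d} (h : Fin d → R) (t : Fin d → Vec R n) c →
              linComb (λ j → h j ∷ t j) c ≡ sum (λ j → c j * h j) ∷ linComb t c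
  linComb-∷ {d = zero}  h t c = refl
  linComb-∷ {d = suc d} h t c = cong (c zero ·ᵥ (h zero ∷ t zero) +ᵥ_) (linComb-∷ (h ∘ suc) (t ∘ suc) (c ∘ suc))

  dot : ∀ {n} → Vec R n → Vec R n → R
  dot = D.dot F

  dot-zeroˡ : ∀ {n} (v : Vec R n) → dot zeroᵥ v ≡ 0#
  dot-zeroˡ []      = refl
  dot-zeroˡ (x ∷ v) = trans (cong₂ _+_ (zeroˡ x) (dot-zeroˡ v)) (+-identityˡ 0#)

  dot-zeroʳ : ∀ {n} (a : Vec R n) → dot a zeroᵥ ≡ 0#
  dot-zeroʳ []      = refl
  dot-zeroʳ (x ∷ a) = trans (cong₂ _+_ (zeroʳ x) (dot-zeroʳ a)) (+-identityˡ 0#)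

  dot-+ᵥˡ : ∀ {n} (a a′ v : Vec R n) → dot (a +ᵥ a′) v ≡ dot a v + dot a′ v
  dot-+ᵥˡ []      []        []      = sym (+-identityˡ 0#)
  dot-+ᵥˡ (x ∷ a) (x′ ∷ a′) (y ∷ v) =
    trans (cong₂ _+_ (distribʳ y x x′) (dot-+ᵥˡ a a′ v)) (+-interchange _ _ _ _)

  dot-+ᵥʳ : ∀ {n} (a u v : Vec R n) → dot a (u +ᵥ v) ≡ dot a u + dot a v
  dot-+ᵥʳ []      []      []      = sym (+-identityˡ 0#)
  dot-+ᵥʳ (x ∷ a) (y ∷ u) (z ∷ v) =
    trans (cong₂ _+_ (distribˡ x y z) (dot-+ᵥʳ a u v)) (+-interchange _ _ _ _)

  dot-negˡ : ∀ {n} (a v : Vec R n) → dot (-ᵥ a) v ≡ - dot a v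
  dot-negˡ []      []      = sym ε⁻¹≈ε
  dot-negˡ (x ∷ a) (y ∷ v) = begin
    - x * y + dot (-ᵥ a) v     ≡⟨ cong₂ _+_ (sym (-‿distribˡ-* x y)) (dot-negˡ a v) ⟩
    - (x * y) + - dot a v      ≡⟨ -‿+-comm (x * y) (dot a v) ⟩
    - (x * y + dot a v)        ∎
    where open ≡-Reasoning

  dot-·ᵥʳ : ∀ {n} (a : Vec R n) c v → dot a (c ·ᵥ v) ≡ c * dot a v
  dot-·ᵥʳ []      c []      = sym (zeroʳ c)
  dot-·ᵥʳ (x ∷ a) c (y ∷ v) = begin
    x * (c * y) + dot a (c ·ᵥ v)  ≡⟨ cong₂ _+_ (x*yz≈y*xz x c y) (dot-·ᵥʳ a c v) ⟩
    c * (x * y) + c * dot a v     ≡⟨ sym (distribˡ c _ _) ⟩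
    c * (x * y + dot a v)         ∎
    where open ≡-Reasoning

  dot-sumᵥʳ : ∀ {n d} (a : Vec R n) (u : Fin d → Vec R n) → dot a (sumᵥ u) ≡ sum (λ j → dot a (u j))
  dot-sumᵥʳ {d = zero}  a u = dot-zeroʳ a
  dot-sumᵥʳ {d = suc d} a u = trans (dot-+ᵥʳ a _ _) (cong (dot a (u zero) +_) (dot-sumᵥʳ a (u ∘ suc)))

  dot-linCombʳ : ∀ {n d} (a : Vec R n) (b : Fin d → Vec R n) c → dot a (linComb b c) ≡ sum (λ j → c j * dot a (b j))
  dot-linCombʳ a b c =
    trans (dot-sumᵥʳ a (λ j → c j ·ᵥ b j)) (sum-cong-≗ (λ j → dot-·ᵥʳ a (c j) (b j)))

  dot-unshear : ∀ {n} (a u v : Vec R n) x {y z} → dot a v ≡ z → dot a (u +ᵥ x ·ᵥ v) ≡ y + x * z → dot a u ≡ y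
  dot-unshear a u v x {y} {z} av≡z eq = ∙-cancelʳ (x * z) (dot a u) y (begin
    dot a u + x * z           ≡⟨ cong (λ w → dot a u + x * w) (sym av≡z) ⟩
    dot a u + x * dot a v     ≡⟨ cong (dot a u +_) (sym (dot-·ᵥʳ a x v)) ⟩
    dot a u + dot a (x ·ᵥ v)  ≡⟨ sym (dot-+ᵥʳ a u (x ·ᵥ v)) ⟩
    dot a (u +ᵥ x ·ᵥ v)       ≡⟨ eq ⟩
    y + x * z                 ∎)
    where open ≡-Reasoning

  linComb-+* : ∀ {n d} (b : Fin d → Vec R n) c x c′ →
               linComb b (λ j → c j + x * c′ j) ≡ linComb b c +ᵥ x ·ᵥ linComb b c′
  linComb-+* b c x c′ = trans (linComb-+ b c (λ j → x * c′ j)) (cong (linComb b c +ᵥ_) (linComb-* b x c′))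

  linComb-drop : ∀ {n d} (b : Fin (suc d) → Vec R n) c i → c i ≡ 0# →
                 linComb b c ≡ linComb (b ∘ punchIn i) (c ∘ punchIn i)
  linComb-drop b c i cᵢ≡0 = begin
    linComb b c                  ≡⟨ linComb-remove b c i ⟩
    c i ·ᵥ b i +ᵥ rest           ≡⟨ cong (λ x → x ·ᵥ b i +ᵥ rest) cᵢ≡0 ⟩
    0# ·ᵥ b i +ᵥ rest            ≡⟨ cong (_+ᵥ rest) (·ᵥ-zeroˡ (b i)) ⟩
    zeroᵥ +ᵥ rest                ≡⟨ +ᵥ-identityˡ rest ⟩
    rest                         ∎
    where
      open ≡-Reasoning
      rest : Vec R _
      rest = linComb (b ∘ punchIn i) (c ∘ punchIn i)

  linComb-shear : ∀ {n d} (b : Fin d → Vec R n) (s : Fin d → R) v c →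
                  linComb (λ j → b j +ᵥ s j ·ᵥ v) c ≡ linComb b c +ᵥ sum (λ j → c j * s j) ·ᵥ v
  linComb-shear {d = zero}  b s v c = sym (trans (cong (zeroᵥ +ᵥ_) (·ᵥ-zeroˡ v)) (+ᵥ-identityˡ zeroᵥ))
  linComb-shear {d = suc d} b s v c = begin
    c zero ·ᵥ (b zero +ᵥ s zero ·ᵥ v) +ᵥ linComb (λ j → b (suc j) +ᵥ s (suc j) ·ᵥ v) (c ∘ suc)
      ≡⟨ cong₂ _+ᵥ_ (trans (·ᵥ-distribˡ (c zero) _ _) (cong (c zero ·ᵥ b zero +ᵥ_) (sym (·ᵥ-assoc (c zero) (s zero) v))))
                    (linComb-shear (b ∘ suc) (s ∘ suc) v (c ∘ suc)) ⟩
    (c zero ·ᵥ b zero +ᵥ (c zero * s zero) ·ᵥ v) +ᵥ (linComb (b ∘ suc) (c ∘ suc) +ᵥ S′ ·ᵥ v)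
      ≡⟨ +ᵥ-interchange _ _ _ _ ⟩
    linComb b c +ᵥ ((c zero * s zero) ·ᵥ v +ᵥ S′ ·ᵥ v)
      ≡⟨ cong (linComb b c +ᵥ_) (sym (·ᵥ-distribʳ _ S′ v)) ⟩
    linComb b c +ᵥ sum (λ j → c j * s j) ·ᵥ v ∎
    where
      open ≡-Reasoning
      S′ : R
      S′ = sum (λ j → c (suc j) * s (suc j))

  linComb-injective : ∀ {n d} {b : Fin d → Vec R n} → LinIndep F b → ∀ c c′ → linComb b c ≡ linComb b c′ → c ≗ c′
  linComb-injective {b = b} indep c c′ eq j = x∙y⁻¹≈ε⇒x≈y (c j) (c′ j) (indep (λ j → c j + - c′ j) difference≡0 j)
    where
      difference≡0 : linComb b (λ j → c j + - c′ j) ≡ zeroᵥ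
      difference≡0 = +ᵥ-cancelʳ (linComb b c′) _ _ (begin
        linComb b (λ j → c j + - c′ j) +ᵥ linComb b c′ ≡⟨ sym (linComb-+ b _ c′) ⟩
        linComb b (λ j → c j + - c′ j + c′ j)         ≡⟨ linComb-cong b (λ j → x-y+y≡x (c′ j) (c j)) ⟩
        linComb b c                                   ≡⟨ eq ⟩
        linComb b c′                                  ≡⟨ sym (+ᵥ-identityˡ _) ⟩
        zeroᵥ +ᵥ linComb b c′                         ∎)
        where open ≡-Reasoning

  LinIndep-nonzero : ∀ {n d} {b : Fin (suc d) → Vec R n} → LinIndep F b → ¬ (∀ j → b j ≡ zeroᵥ)
  LinIndep-nonzero {n} {d} {b} indep b≡0 =
    0≢1 (sym (indep (λ _ → 1#) (trans (linComb-congˡ b≡0 (λ _ → 1#)) (linComb-zeroᵥ {n} {suc d} (λ _ → 1#))) zero))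

  LinIndep-eliminate : ∀ {n d} {b : Fin (suc d) → Vec R n} → LinIndep F b → ∀ i (s : Fin d → R) →
                       LinIndep F (λ j → b (punchIn i j) +ᵥ s j ·ᵥ b i)
  LinIndep-eliminate {b = b} indep i s c eq j =
    trans (sym (VectorP.insertAt-punchIn c i S j)) (indep c′ c′-relation (punchIn i j))
    where
      S : R
      S = sum (λ j → c j * s j)
      c′ : Fin (suc _) → R
      c′ = Vector.insertAt c i S
      c′-relation : linComb b c′ ≡ zeroᵥ
      c′-relation = begin
        linComb b c′                                       ≡⟨ linComb-remove b c′ i ⟩
        c′ i ·ᵥ b i +ᵥ linComb (b ∘ punchIn i) (c′ ∘ punchIn i)
          ≡⟨ cong₂ (λ x y → x ·ᵥ b i +ᵥ y) (VectorP.insertAt-lookup c i S)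
                   (linComb-cong (b ∘ punchIn i) (VectorP.insertAt-punchIn c i S)) ⟩
        S ·ᵥ b i +ᵥ linComb (b ∘ punchIn i) c              ≡⟨ +ᵥ-comm _ _ ⟩
        linComb (b ∘ punchIn i) c +ᵥ S ·ᵥ b i              ≡⟨ sym (linComb-shear (b ∘ punchIn i) s (b i) c) ⟩
        linComb (λ j → b (punchIn i j) +ᵥ s j ·ᵥ b i) c    ≡⟨ eq ⟩
        zeroᵥ                                              ∎
        where open ≡-Reasoning

  zero-or-pivot : ∀ {d} (f : Fin d → R) → (∀ j → f j ≡ 0#) ⊎ ∃ λ j → f j ≢ 0#
  zero-or-pivot f with Fin.any? (λ j → ¬? (f j ≟ 0#))
  ... | yes pivot = inj₂ pivot
  ... | no  none  = inj₁ λ j → decidable-stable (f j ≟ 0#) (λ fj≢0 → none (j , fj≢0))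

  module Pivot {p : R} (p≢0 : p ≢ 0#) where

    p⁻¹ : R
    p⁻¹ = proj₁ (inverse p p≢0)

    p⁻¹*p≡1 : p⁻¹ * p ≡ 1#
    p⁻¹*p≡1 = trans (*-comm p⁻¹ p) (proj₂ (inverse p p≢0))

    clear : R → R
    clear h = - (h * p⁻¹)

    clear-clears : ∀ h → h + clear h * p ≡ 0#
    clear-clears h = begin
      h + - (h * p⁻¹) * p    ≡⟨ cong (h +_) (sym (-‿distribˡ-* (h * p⁻¹) p)) ⟩
      h + - (h * p⁻¹ * p)    ≡⟨ cong (λ x → h + - x) (*-assoc h p⁻¹ p) ⟩
      h + - (h * (p⁻¹ * p))  ≡⟨ cong (λ x → h + - (h * x)) p⁻¹*p≡1 ⟩
      h + - (h * 1#)         ≡⟨ cong (λ x → h + - x) (*-identityʳ h) ⟩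
      h + - h                ≡⟨ -‿inverseʳ h ⟩
      0#                     ∎
      where open ≡-Reasoning

    back-substitute : ∀ y x → (y + - x) * p⁻¹ * p + x ≡ y
    back-substitute y x = begin
      (y + - x) * p⁻¹ * p + x    ≡⟨ cong (_+ x) (*-assoc (y + - x) p⁻¹ p) ⟩
      (y + - x) * (p⁻¹ * p) + x  ≡⟨ cong (λ z → (y + - x) * z + x) p⁻¹*p≡1 ⟩
      (y + - x) * 1# + x         ≡⟨ cong (_+ x) (*-identityʳ (y + - x)) ⟩
      y + - x + x                ≡⟨ x-y+y≡x x y ⟩
      y                          ∎
      where open ≡-Reasoning

  linComb-combine : ∀ {n d} (C : Fin d → Vec R n) {v w} c c′ → v ≡ linComb C c → w ≡ linComb C c′ →
                    ∀ x → v +ᵥ x ·ᵥ w ≡ linComb C (λ k → c k + x * c′ k)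
  linComb-combine C c c′ refl refl x = sym (linComb-+* C c x c′)

  -- Steinitz: if some b_j uses C₀, pivot on it to eliminate C₀ from the others; otherwise drop C₀.
  LinIndep⇒≤-spanning : ∀ {n m d} (C : Fin m → Vec R n) {b : Fin d → Vec R n} → LinIndep F b →
                        (∀ j → InSpan F C (b j)) → d ℕ.≤ m
  LinIndep⇒≤-spanning {m = zero}  {zero}  C indep span = ℕ.z≤n
  LinIndep⇒≤-spanning {m = zero}  {suc d} C indep span = contradiction (proj₂ ∘ span) (LinIndep-nonzero indep)
  LinIndep⇒≤-spanning {m = suc m} {zero}  C indep span = ℕ.z≤n
  LinIndep⇒≤-spanning {m = suc m} {suc d} C {b} indep span with zero-or-pivot (λ j → proj₁ (span j) zero)
  ... | inj₁ heads≡0 = ℕ.m≤n⇒m≤1+n (LinIndep⇒≤-spanning (C ∘ suc) indep span′)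
    where
      span′ : ∀ j → InSpan F (C ∘ suc) (b j)
      span′ j = let c , bj≡ = span j in c ∘ suc , trans bj≡ (linComb-drop C c zero (heads≡0 j))
  ... | inj₂ (i , pivot) = s≤s (LinIndep⇒≤-spanning (C ∘ suc) (LinIndep-eliminate {b = b} indep i multiplier) span′)
    where
      coeff : Fin (suc d) → Fin (suc m) → R
      coeff = proj₁ ∘ span
      open Pivot pivot
      multiplier : Fin d → R
      multiplier j = clear (coeff (punchIn i j) zero)
      span′ : ∀ j → InSpan F (C ∘ suc) (b (punchIn i j) +ᵥ multiplier j ·ᵥ b i)
      span′ j = combined ∘ suc ,
        trans (linComb-combine C (coeff (punchIn i j)) (coeff i) (proj₂ (span (punchIn i j))) (proj₂ (span i)) (multiplier j))
              (linComb-drop C combined zero (clear-clears (coeff (punchIn i j) zero)))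
        where
          combined : Fin (suc m) → R
          combined k = coeff (punchIn i j) k + multiplier j * coeff i k

  -- A nontrivial relation among C lets one drop a vector of C, contradicting Steinitz.
  spanning⇒LinIndep : ∀ {n d} (C : Fin d → Vec R n) {b : Fin d → Vec R n} → LinIndep F b →
                      (∀ j → InSpan F C (b j)) → LinIndep F C
  spanning⇒LinIndep C indep span e Ce≡0 k with e k ≟ 0#
  ... | yes eₖ≡0 = eₖ≡0
  spanning⇒LinIndep {d = suc d} C {b} indep span e Ce≡0 k | no eₖ≢0 =
    contradiction (LinIndep⇒≤-spanning (C ∘ punchIn k) indep span′) ℕ.1+n≰n
    where
      open Pivot eₖ≢0
      coeff : Fin (suc d) → Fin (suc d) → R
      coeff = proj₁ ∘ span
      span′ : ∀ j → InSpan F (C ∘ punchIn k) (b j)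
      span′ j = combined ∘ punchIn k , (begin
        b j                                     ≡⟨ sym (+ᵥ-identityʳ (b j)) ⟩
        b j +ᵥ zeroᵥ                            ≡⟨ cong (b j +ᵥ_) (sym (·ᵥ-zeroʳ x)) ⟩
        b j +ᵥ x ·ᵥ zeroᵥ                       ≡⟨ linComb-combine C (coeff j) e (proj₂ (span j)) (sym Ce≡0) x ⟩
        linComb C combined                      ≡⟨ linComb-drop C combined k (clear-clears (coeff j k)) ⟩
        linComb (C ∘ punchIn k) (combined ∘ punchIn k) ∎)
        where
          open ≡-Reasoning
          x : R
          x = clear (coeff j k)
          combined : Fin (suc d) → R
          combined l = coeff j l + x * e l

  ∷-η : ∀ {n} (v : Vec R (suc n)) → Vec.head v ∷ Vec.tail v ≡ v
  ∷-η (x ∷ v) = refl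

  LinIndep-tail : ∀ {n d} {h : Fin d → R} {t : Fin d → Vec R n} → LinIndep F (λ j → h j ∷ t j) →
                  (∀ j → h j ≡ 0#) → LinIndep F t
  LinIndep-tail {d = d} {h} {t} indep h≡0 c tc≡0 = indep c (begin
    linComb (λ j → h j ∷ t j) c          ≡⟨ linComb-∷ h t c ⟩
    sum (λ j → c j * h j) ∷ linComb t c  ≡⟨ cong₂ _∷_ ∑ch≡0 tc≡0 ⟩
    zeroᵥ                                ∎)
    where
      open ≡-Reasoning
      ∑ch≡0 : sum (λ j → c j * h j) ≡ 0#
      ∑ch≡0 = trans (sum-cong-≗ (λ j → trans (cong (c j *_) (h≡0 j)) (zeroʳ (c j)))) (sum-replicate-zero d)

  -- Gaussian elimination on the first coordinate: clear the pivot's head from the other vectors,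
  -- solve the reduced system, then pick the first coordinate of a to satisfy the pivot equation.
  mutual
    dot-solvable : ∀ n {d} {b : Fin d → Vec R n} → LinIndep F b →
                   (c : Fin d → R) → ∃ λ a → ∀ j → dot a (b j) ≡ c j
    dot-solvable zero    {zero}  indep c = [] , λ ()
    dot-solvable zero    {suc d} {b} indep c = contradiction (λ j → []-η (b j)) (LinIndep-nonzero indep)
      where []-η : (v : Vec R 0) → v ≡ zeroᵥ
            []-η [] = refl
    dot-solvable (suc n) {b = b} indep c =
      let a , sol = dot-solvable-∷ n (λ e eq → indep e (trans (linComb-congˡ (sym ∘ ∷-η ∘ b) e) eq)) c
      in a , λ j → trans (cong (dot a) (sym (∷-η (b j)))) (sol j)

    dot-solvable-∷ : ∀ n {d} {h : Fin d → R} {t : Fin d → Vec R n} → LinIndep F (λ j → h j ∷ t j) →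
                     (c : Fin d → R) → ∃ λ a → ∀ j → dot a (h j ∷ t j) ≡ c j
    dot-solvable-∷ n {h = h} {t} indep c with zero-or-pivot h
    ... | inj₁ h≡0 = let a , sol = dot-solvable n (LinIndep-tail indep h≡0) c in
      0# ∷ a , λ j → trans (cong (_+ dot a (t j)) (zeroˡ (h j))) (trans (+-identityˡ _) (sol j))
    dot-solvable-∷ n {suc d} {h} {t} indep c | inj₂ (i , pivot) = α ∷ a′ , ∀-punchIn i solᵢ sol-punchIn
      where
        open Pivot pivot
        m : Fin d → R
        m j = clear (h (punchIn i j))
        t′ : Fin d → Vec R n
        t′ j = t (punchIn i j) +ᵥ m j ·ᵥ t i
        indep′ : LinIndep F (λ j → (h (punchIn i j) + m j * h i) ∷ t′ j)
        indep′ = LinIndep-eliminate {b = λ j → h j ∷ t j} indep i m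
        reduced : ∃ λ a′ → ∀ j → dot a′ (t′ j) ≡ c (punchIn i j) + m j * c i
        reduced = dot-solvable n (LinIndep-tail indep′ (clear-clears ∘ h ∘ punchIn i)) (λ j → c (punchIn i j) + m j * c i)
        a′ : Vec R n
        a′ = proj₁ reduced
        α : R
        α = (c i + - dot a′ (t i)) * p⁻¹
        solᵢ : dot (α ∷ a′) (h i ∷ t i) ≡ c i
        solᵢ = back-substitute (c i) (dot a′ (t i))
        sol-punchIn : ∀ j → dot (α ∷ a′) (h (punchIn i j) ∷ t (punchIn i j)) ≡ c (punchIn i j)
        sol-punchIn j = dot-unshear (α ∷ a′) (h (punchIn i j) ∷ t (punchIn i j)) (h i ∷ t i) (m j) solᵢ (begin
          α * (h (punchIn i j) + m j * h i) + dot a′ (t′ j)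
            ≡⟨ cong (λ x → α * x + dot a′ (t′ j)) (clear-clears (h (punchIn i j))) ⟩
          α * 0# + dot a′ (t′ j)                             ≡⟨ cong (_+ dot a′ (t′ j)) (zeroʳ α) ⟩
          0# + dot a′ (t′ j)                                 ≡⟨ +-identityˡ (dot a′ (t′ j)) ⟩
          dot a′ (t′ j)                                      ≡⟨ proj₂ reduced j ⟩
          c (punchIn i j) + m j * c i                        ∎)
          where open ≡-Reasoning

  -- Counting solutions of linear systems

  elements : List R
  elements = List.map (Inverse.to enumeration) (List.allFin q)

  elements-unique : Unique elements
  elements-unique = Unique.map⁺ (Injection.injective (↔⇒↣ enumeration)) (Unique.allFin⁺ q)

  ∈-elements : ∀ x → x ∈ elements
  ∈-elements x = subst (_∈ elements) (Inverse.strictlyInverseˡ enumeration x)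
                       (Membership.∈-map⁺ (Inverse.to enumeration) (Membership.∈-allFin _))

  vectors : ∀ n → List (Vec R n)
  vectors zero    = [] List.∷ List.[]
  vectors (suc n) = List.cartesianProductWith _∷_ elements (vectors n)

  vectors-unique : ∀ n → Unique (vectors n)
  vectors-unique zero    = All.[] AllPairs.∷ AllPairs.[]
  vectors-unique (suc n) = Unique.cartesianProductWith⁺ _∷_ Vec.∷-injective elements-unique (vectors-unique n)

  ∈-vectors : ∀ {n} (v : Vec R n) → v ∈ vectors n
  ∈-vectors []      = Any.here refl
  ∈-vectors (x ∷ v) = Membership.∈-cartesianProductWith⁺ _∷_ (∈-elements x) (∈-vectors v)

  Solves : ∀ {n d} → (Fin d → Vec R n) → (Fin d → R) → Vec R n → Set
  Solves C T a = ∀ j → dot a (C j) ≡ T j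

  Solves? : ∀ {n d} (C : Fin d → Vec R n) T → Decidable (Solves C T)
  Solves? C T a = Fin.all? (λ j → dot a (C j) ≟ T j)

  kernel : ∀ {n d} → (Fin d → Vec R n) → List (Vec R n)
  kernel {n} C = List.filter (Solves? C (λ _ → 0#)) (vectors n)

  Solves-+ᵥ : ∀ {n d} {C : Fin d → Vec R n} {T a x} → Solves C T a → Solves C (λ _ → 0#) x → Solves C T (a +ᵥ x)
  Solves-+ᵥ {C = C} {T} {a} {x} a-sol x-sol j = begin
    dot (a +ᵥ x) (C j)       ≡⟨ dot-+ᵥˡ a x (C j) ⟩
    dot a (C j) + dot x (C j) ≡⟨ cong₂ _+_ (a-sol j) (x-sol j) ⟩
    T j + 0#                 ≡⟨ +-identityʳ (T j) ⟩
    T j                      ∎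
    where open ≡-Reasoning

  Solves-difference : ∀ {n d} {C : Fin d → Vec R n} {T a₀ a} → Solves C T a₀ → Solves C T a →
                      Solves C (λ _ → 0#) (-ᵥ a₀ +ᵥ a)
  Solves-difference {C = C} {T} {a₀} {a} a₀-sol a-sol j = begin
    dot (-ᵥ a₀ +ᵥ a) (C j)            ≡⟨ dot-+ᵥˡ (-ᵥ a₀) a (C j) ⟩
    dot (-ᵥ a₀) (C j) + dot a (C j)   ≡⟨ cong₂ _+_ (dot-negˡ a₀ (C j)) (a-sol j) ⟩
    - dot a₀ (C j) + T j              ≡⟨ cong (λ x → - x + T j) (a₀-sol j) ⟩
    - T j + T j                       ≡⟨ -‿inverseˡ (T j) ⟩
    0#                                ∎
    where open ≡-Reasoning

  solutions-count : ∀ {n d} {C : Fin d → Vec R n} → LinIndep F C → ∀ T →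
                    CountIs (Solves C T) (List.length (kernel C))
  solutions-count {n} {C = C} indep T =
    List.map (a₀ +ᵥ_) (kernel C) , unique , all , complete , List.length-map (a₀ +ᵥ_) (kernel C)
    where
      a₀ : Vec R n
      a₀ = proj₁ (dot-solvable n indep T)
      a₀-sol : Solves C T a₀
      a₀-sol = proj₂ (dot-solvable n indep T)
      unique : Unique (List.map (a₀ +ᵥ_) (kernel C))
      unique = Unique.map⁺ (+ᵥ-cancelˡ a₀ _ _) (Unique.filter⁺ (Solves? C _) (vectors-unique n))
      all : All (Solves C T) (List.map (a₀ +ᵥ_) (kernel C))
      all = All.map⁺ (All.tabulate λ {x} x∈ker →
        Solves-+ᵥ {C = C} {a = a₀} {x} a₀-sol (proj₂ (Membership.∈-filter⁻ (Solves? C _) {xs = vectors n} x∈ker)))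
      complete : ∀ a → Solves C T a → a ∈ List.map (a₀ +ᵥ_) (kernel C)
      complete a a-sol = subst (_∈ List.map (a₀ +ᵥ_) (kernel C)) a₀+[a-a₀]≡a
        (Membership.∈-map⁺ (a₀ +ᵥ_) (Membership.∈-filter⁺ (Solves? C _) (∈-vectors _)
          (Solves-difference {C = C} {a₀ = a₀} {a} a₀-sol a-sol)))
        where
          a₀+[a-a₀]≡a : a₀ +ᵥ (-ᵥ a₀ +ᵥ a) ≡ a
          a₀+[a-a₀]≡a = trans (sym (+ᵥ-assoc a₀ (-ᵥ a₀) a)) (trans (cong (_+ᵥ a) (-ᵥ‿inverseʳ a₀)) (+ᵥ-identityˡ a))

  -- Subspaces and linear functionals

  module _ {n : ℕ} (W : Subspace F n) where

    basis : Fin (dim W) → Vec R n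
    basis = proj₁ (hasDim W)

    basis-mem : ∀ l → mem W (basis l)
    basis-mem = proj₁ (proj₂ (hasDim W))

    basis-indep : LinIndep F basis
    basis-indep = proj₁ (proj₂ (proj₂ (hasDim W)))

    basis-spans : ∀ v → mem W v → InSpan F basis v
    basis-spans = proj₂ (proj₂ (proj₂ (hasDim W)))

    coordinates : ∀ v → mem W v → Fin (dim W) → R
    coordinates v p = proj₁ (basis-spans v p)

    linComb-mem : ∀ {d} {b : Fin d → Vec R n} → (∀ j → mem W (b j)) → ∀ c → mem W (linComb b c)
    linComb-mem {zero}  b-mem c = zero-mem W
    linComb-mem {suc d} b-mem c =
      add-mem W _ _ (scal-mem W (c zero) _ (b-mem zero)) (linComb-mem (b-mem ∘ suc) (c ∘ suc))

    Represents : Vec R n → Dual F W → Set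
    Represents a g = ∀ v p → app g v p ≡ dot a v

    -- Homogeneity for the scalar 1 shows that app does not depend on the membership proof.
    app-cong : (g : Dual F W) → ∀ {u v} → u ≡ v → ∀ p p′ → app g u p ≡ app g v p′
    app-cong g {v = v} refl p p′ = begin
      app g v p                       ≡⟨ sym (*-identityˡ _) ⟩
      1# * app g v p                  ≡⟨ sym (homog g 1# v p 1v∈W) ⟩
      app g (1# ·ᵥ v) 1v∈W            ≡⟨ homog g 1# v p′ 1v∈W ⟩
      1# * app g v p′                 ≡⟨ *-identityˡ _ ⟩
      app g v p′                      ∎
      where
        open ≡-Reasoning
        1v∈W : mem W (1# ·ᵥ v)
        1v∈W = scal-mem W 1# v p

    app-zero : (g : Dual F W) → ∀ p → app g zeroᵥ p ≡ 0#
    app-zero g p = begin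
      app g zeroᵥ p                   ≡⟨ app-cong g (sym (·ᵥ-zeroˡ zeroᵥ)) p 0v∈W ⟩
      app g (0# ·ᵥ zeroᵥ) 0v∈W        ≡⟨ homog g 0# zeroᵥ p 0v∈W ⟩
      0# * app g zeroᵥ p              ≡⟨ zeroˡ _ ⟩
      0#                              ∎
      where
        open ≡-Reasoning
        0v∈W : mem W (0# ·ᵥ zeroᵥ)
        0v∈W = scal-mem W 0# zeroᵥ p

    app-linComb : (g : Dual F W) → ∀ {d} {b : Fin d → Vec R n} (b-mem : ∀ j → mem W (b j)) c p →
                  app g (linComb b c) p ≡ sum (λ j → c j * app g (b j) (b-mem j))
    app-linComb g {zero}  b-mem c p = app-zero g p
    app-linComb g {suc d} b-mem c p =
      trans (additive g _ _ (scal-mem W (c zero) _ (b-mem zero)) (linComb-mem (b-mem ∘ suc) (c ∘ suc)) p)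
            (cong₂ _+_ (homog g (c zero) _ (b-mem zero) _) (app-linComb g (b-mem ∘ suc) (c ∘ suc) _))

    Represents-basis : ∀ a g → Represents a g → ∀ l → dot a (basis l) ≡ app g (basis l) (basis-mem l)
    Represents-basis a g rep l = sym (rep (basis l) (basis-mem l))

    basis-Represents : ∀ a g → (∀ l → dot a (basis l) ≡ app g (basis l) (basis-mem l)) → Represents a g
    basis-Represents a g agree v p = begin
      app g v p                                     ≡⟨ app-cong g v≡bc p (linComb-mem basis-mem c) ⟩
      app g (linComb basis c) _                     ≡⟨ app-linComb g basis-mem c _ ⟩
      sum (λ l → c l * app g (basis l) (basis-mem l)) ≡⟨ sum-cong-≗ (λ l → cong (c l *_) (sym (agree l))) ⟩
      sum (λ l → c l * dot a (basis l))             ≡⟨ sym (dot-linCombʳ a basis c) ⟩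
      dot a (linComb basis c)                       ≡⟨ cong (dot a) (sym v≡bc) ⟩
      dot a v                                       ∎
      where
        open ≡-Reasoning
        c : Fin (dim W) → R
        c = coordinates v p
        v≡bc : v ≡ linComb basis c
        v≡bc = proj₂ (basis-spans v p)

    label : Labeling F W → Dual F W → Fin (q ^ dim W)
    label L g = proj₁ (surj L g)

    EntryIs⇔Represents : ∀ L g a → EntryIs F L a (label L g) ⇔ Represents a g
    EntryIs⇔Represents L g a = mk⇔
      (λ entry v p → trans (sym (proj₂ (surj L g) v p)) (entry v p))
      (λ rep v p → trans (proj₂ (surj L g) v p) (rep v p))

    zeroDual : Dual F W
    zeroDual = record
      { app = λ _ _ → 0# ; additive = λ _ _ _ _ _ → sym (+-identityˡ 0#) ; homog = λ c _ _ _ → sym (zeroʳ c) }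

    zeroDual-Represents : Represents zeroᵥ zeroDual
    zeroDual-Represents v p = sym (dot-zeroˡ v)

    coordinates-unique : ∀ {v} p c → v ≡ linComb basis c → coordinates v p ≗ c
    coordinates-unique p c v≡bc =
      linComb-injective basis-indep _ c (trans (sym (proj₂ (basis-spans _ p))) v≡bc)

    coordinate : Fin (dim W) → Dual F W
    coordinate l = record
      { app      = λ v p → coordinates v p l
      ; additive = λ u v pu pv puv → coordinates-unique puv _
          (trans (cong₂ _+ᵥ_ (proj₂ (basis-spans u pu)) (proj₂ (basis-spans v pv))) (sym (linComb-+ basis _ _))) l
      ; homog    = λ x u pu pxu → coordinates-unique pxu _
          (trans (cong (x ·ᵥ_) (proj₂ (basis-spans u pu))) (sym (linComb-* basis x _))) l
      }

    coordinates-zero⇒zero : ∀ v p → (∀ l → coordinates v p l ≡ 0#) → v ≡ zeroᵥ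
    coordinates-zero⇒zero v p coords≡0 =
      trans (proj₂ (basis-spans v p)) (trans (linComb-cong basis coords≡0) (linComb-zero basis))

  linComb-concat : ∀ {n τ} {d : Fin τ → ℕ} (b : (s : Fin τ) → Fin (d s) → Vec R n) c →
                   linComb (concat b) c ≡ sumᵥ (λ s → linComb (b s) (c ∘ inject {d = d} s))
  linComb-concat {τ = zero}      b c = refl
  linComb-concat {τ = suc τ} {d} b c = begin
    linComb (concat b) c
      ≡⟨ linComb-++ (d zero) (concat b) c ⟩
    linComb (concat b ∘ ι zero) (c ∘ ι zero) +ᵥ linComb (λ m → concat b (d zero ↑ʳ m)) (λ m → c (d zero ↑ʳ m))
      ≡⟨ cong₂ _+ᵥ_ (linComb-congˡ (concat-inject b zero) (c ∘ ι zero))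
                    (linComb-congˡ (concat-↑ʳ b) (λ m → c (d zero ↑ʳ m))) ⟩
    linComb (b zero) (c ∘ ι zero) +ᵥ linComb (concat (b ∘ suc)) (λ m → c (d zero ↑ʳ m))
      ≡⟨ cong (linComb (b zero) (c ∘ ι zero) +ᵥ_) (linComb-concat (b ∘ suc) (λ m → c (d zero ↑ʳ m))) ⟩
    sumᵥ (λ s → linComb (b s) (c ∘ ι s)) ∎
    where
      open ≡-Reasoning
      ι : (s : Fin (suc τ)) → Fin (d s) → Fin (sumℕ d)
      ι = inject

  module _ {n τ : ℕ} (W : Fin τ → Subspace F n) where

    dims : Fin τ → ℕ
    dims s = dim (W s)

    ι : (s : Fin τ) → Fin (dims s) → Fin (sumℕ dims)
    ι = inject

    jointBasis : Fin (sumℕ dims) → Vec R n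
    jointBasis = concat (λ s → basis (W s))

    mem⇒SpanOf : ∀ s {v} → mem (W s) v → SpanOf F W v
    mem⇒SpanOf s {v} v∈Wₛ = u , u-mem , sym ∑u≡v
      where
        u : Fin τ → Vec R n
        u = Vector.updateAt (λ _ → zeroᵥ) s (λ _ → v)
        u-other : ∀ s′ → s′ ≢ s → u s′ ≡ zeroᵥ
        u-other s′ = VectorP.updateAt-minimal s′ s _
        u-mem : ∀ s′ → mem (W s′) (u s′)
        u-mem s′ with s′ Fin.≟ s
        ... | yes refl = subst (mem (W s)) (sym (VectorP.updateAt-updates s _)) v∈Wₛ
        ... | no s′≢s  = subst (mem (W s′)) (sym (u-other s′ s′≢s)) (zero-mem (W s′))
        ∑u≡v : sumᵥ u ≡ v
        ∑u≡v = trans (sumᵥ≡∑ᵥ u) (trans (sum-single (AbelianGroup.commutativeMonoid (+ᵥ-abelianGroup n)) u s u-other)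
                                         (VectorP.updateAt-updates s _))

    jointBasis-mem : ∀ m → SpanOf F W (jointBasis m)
    jointBasis-mem = ∀-inject λ s l →
      mem⇒SpanOf s (subst (mem (W s)) (sym (concat-inject (λ s → basis (W s)) s l)) (basis-mem (W s) l))

    jointBasis-spans : ∀ v → SpanOf F W v → InSpan F jointBasis v
    jointBasis-spans v (u , u-mem , v≡∑u) = concat c , (begin
      v
        ≡⟨ v≡∑u ⟩
      sumᵥ u
        ≡⟨ sumᵥ-cong (λ s → proj₂ (basis-spans (W s) (u s) (u-mem s))) ⟩
      sumᵥ (λ s → linComb (basis (W s)) (c s))
        ≡⟨ sumᵥ-cong (λ s → linComb-cong (basis (W s)) (sym ∘ concat-inject c s)) ⟩
      sumᵥ (λ s → linComb (basis (W s)) (concat c ∘ ι s))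
        ≡⟨ sym (linComb-concat (λ s → basis (W s)) (concat c)) ⟩
      linComb jointBasis (concat c)
        ∎)
      where
        open ≡-Reasoning
        c : (s : Fin τ) → Fin (dim (W s)) → R
        c s = coordinates (W s) (u s) (u-mem s)

    DirectSum : Set
    DirectSum = ∀ u → (∀ s → mem (W s) (u s)) → sumᵥ u ≡ zeroᵥ → ∀ s → u s ≡ zeroᵥ

    DirectSum⇒jointBasis-indep : DirectSum → LinIndep F jointBasis
    DirectSum⇒jointBasis-indep direct c c≡0 = ∀-inject λ s l →
      basis-indep (W s) (c ∘ ι s) (direct parts parts-mem (trans (sym (linComb-concat (λ s → basis (W s)) c)) c≡0) s) l
      where
        parts : Fin τ → Vec R n
        parts s = linComb (basis (W s)) (c ∘ ι s)
        parts-mem : ∀ s → mem (W s) (parts s)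
        parts-mem s = linComb-mem (W s) (basis-mem (W s)) (c ∘ ι s)

    DirectSum⇒HasDim : DirectSum → HasDim F (SpanOf F W) (sumℕ dims)
    DirectSum⇒HasDim direct = jointBasis , jointBasis-mem , DirectSum⇒jointBasis-indep direct , jointBasis-spans

    HasDim⇒jointBasis-indep : HasDim F (SpanOf F W) (sumℕ dims) → LinIndep F jointBasis
    HasDim⇒jointBasis-indep (b , b-mem , b-indep , _) =
      spanning⇒LinIndep jointBasis b-indep (λ j → jointBasis-spans (b j) (b-mem j))

    jointTarget : ((s : Fin τ) → Dual F (W s)) → Fin (sumℕ dims) → R
    jointTarget g = concat (λ s l → app (g s) (basis (W s) l) (basis-mem (W s) l))

    Represents⇒Solves : ∀ {a g} → (∀ s → Represents (W s) a (g s)) → Solves jointBasis (jointTarget g) a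
    Represents⇒Solves {a} {g} rep = ∀-inject λ s l → begin
      dot a (jointBasis (ι s l))                    ≡⟨ cong (dot a) (concat-inject _ s l) ⟩
      dot a (basis (W s) l)                         ≡⟨ Represents-basis (W s) a (g s) (rep s) l ⟩
      app (g s) (basis (W s) l) (basis-mem (W s) l) ≡⟨ sym (concat-inject _ s l) ⟩
      jointTarget g (ι s l)                         ∎
      where open ≡-Reasoning

    Solves⇒Represents : ∀ {a g} → Solves jointBasis (jointTarget g) a → ∀ s → Represents (W s) a (g s)
    Solves⇒Represents {a} {g} sol s = basis-Represents (W s) a (g s) λ l → begin
      dot a (basis (W s) l)                         ≡⟨ cong (dot a) (sym (concat-inject _ s l)) ⟩
      dot a (jointBasis (ι s l))                    ≡⟨ sol (ι s l) ⟩
      jointTarget g (ι s l)                         ≡⟨ concat-inject _ s l ⟩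
      app (g s) (basis (W s) l) (basis-mem (W s) l) ∎
      where open ≡-Reasoning

  -- Orthogonal arrays and mixed spreads

  module _ {n k : ℕ} (V : Fin k → Subspace F n) where

    Realizable : ∀ {τ} → (Fin τ → Fin k) → Set
    Realizable i = (G : (c : Fin k) → Dual F (V c)) → ∃ λ a → ∀ s → Represents (V (i s)) a (G (i s))

    Realizable-restrict : ∀ {τ t} {i : Fin τ → Fin k} (E : Extension t i) →
                          Realizable (Extension.indices E) → Realizable i
    Realizable-restrict E realizable G = let a , rep = realizable G in
      a , λ s → let s′ , eq = covers s in subst (λ c → Represents (V c) a (G c)) eq (rep s′)
      where open Extension E

    -- The all-zero tuple occurs in the zero row, so every tuple occurs as often, hence at least once.
    OA⇒Realizable : ∀ {t} (L : (c : Fin k) → Labeling F (V c)) → IsOAofStrength F V L t →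
                    ∀ {i} → StrictlyIncreasing i → Realizable i
    OA⇒Realizable L oa {i} inc G =
      proj₁ row , λ s → Equivalence.to (EntryIs⇔Represents (V (i s)) (L (i s)) (G (i s)) (proj₁ row)) (proj₂ row s)
      where
        count : ∀ js → CountIs (λ a → ∀ s → EntryIs F (L (i s)) a (js s)) (proj₁ (oa i inc))
        count = proj₂ (oa i inc)
        zero-row : ∀ s → EntryIs F (L (i s)) zeroᵥ (label (V (i s)) (L (i s)) (zeroDual (V (i s))))
        zero-row s = Equivalence.from (EntryIs⇔Represents (V (i s)) (L (i s)) (zeroDual (V (i s))) zeroᵥ)
                                      (zeroDual-Represents (V (i s)))
        row : ∃ λ a → ∀ s → EntryIs F (L (i s)) a (label (V (i s)) (L (i s)) (G (i s)))
        row = CountIs-witness {a = zeroᵥ} (count (λ s → label (V (i s)) (L (i s)) (zeroDual (V (i s))))) zero-row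
                              (count (λ s → label (V (i s)) (L (i s)) (G (i s))))

    single : (c₀ : Fin k) → Dual F (V c₀) → (c : Fin k) → Dual F (V c)
    single c₀ g c with c Fin.≟ c₀
    ... | yes refl = g
    ... | no  _    = zeroDual (V c)

    single-self : ∀ c₀ g → single c₀ g c₀ ≡ g
    single-self c₀ g with c₀ Fin.≟ c₀
    ... | yes refl   = refl
    ... | no  c₀≢c₀  = contradiction refl c₀≢c₀

    single-other : ∀ c₀ g c → c ≢ c₀ → single c₀ g c ≡ zeroDual (V c)
    single-other c₀ g c c≢c₀ with c Fin.≟ c₀
    ... | yes c≡c₀ = contradiction c≡c₀ c≢c₀
    ... | no  _    = refl

    -- Realize the l-th coordinate functional of V (i s₀) and zero on the other columns.
    Realizable⇒DirectSum : ∀ {τ} {i : Fin τ → Fin k} → Injective _≡_ _≡_ i → Realizable i → DirectSum (V ∘ i)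
    Realizable⇒DirectSum {i = i} i-injective realizable u u-mem ∑u≡0 s₀ =
      coordinates-zero⇒zero (V (i s₀)) (u s₀) (u-mem s₀) coordinate≡0
      where
        coordinate≡0 : ∀ l → coordinates (V (i s₀)) (u s₀) (u-mem s₀) l ≡ 0#
        coordinate≡0 l = begin
          coordinates (V (i s₀)) (u s₀) (u-mem s₀) l
            ≡⟨ cong (λ g → app g (u s₀) (u-mem s₀)) (sym (single-self (i s₀) _)) ⟩
          app (G (i s₀)) (u s₀) (u-mem s₀)
            ≡⟨ sym (sum-single (CommutativeRing.+-commutativeMonoid ring) _ s₀ others≡0) ⟩
          sum (λ s → app (G (i s)) (u s) (u-mem s))       ≡⟨ sum-cong-≗ (λ s → rep s (u s) (u-mem s)) ⟩
          sum (λ s → dot a (u s))                         ≡⟨ sym (dot-sumᵥʳ a u) ⟩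
          dot a (sumᵥ u)                                  ≡⟨ cong (dot a) ∑u≡0 ⟩
          dot a zeroᵥ                                     ≡⟨ dot-zeroʳ a ⟩
          0#                                              ∎
          where
            open ≡-Reasoning
            G : (c : Fin k) → Dual F (V c)
            G = single (i s₀) (coordinate (V (i s₀)) l)
            a : Vec R n
            a = proj₁ (realizable G)
            rep : ∀ s → Represents (V (i s)) a (G (i s))
            rep = proj₂ (realizable G)
            others≡0 : ∀ s → s ≢ s₀ → app (G (i s)) (u s) (u-mem s) ≡ 0#
            others≡0 s s≢s₀ = cong (λ g → app g (u s) (u-mem s)) (single-other (i s₀) _ (i s) (s≢s₀ ∘ i-injective))

    MixedSpread⇒OA : ∀ {t} (L : (c : Fin k) → Labeling F (V c)) → MixedSpread F V t → IsOAofStrength F V L t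
    MixedSpread⇒OA {t} L spread i inc = List.length (kernel (jointBasis W)) , count
      where
        W : Fin t → Subspace F n
        W = V ∘ i
        count : (js : (s : Fin t) → Fin (q ^ dim (W s))) →
                CountIs (λ a → ∀ s → EntryIs F (L (i s)) a (js s)) (List.length (kernel (jointBasis W)))
        count js = CountIs-resp (λ {a} → Solves⇒Represents W {a} {g}) (λ {a} → Represents⇒Solves W {a} {g})
          (solutions-count (HasDim⇒jointBasis-indep W (spread t ℕ.≤-refl i inc)) (jointTarget W g))
          where
            g : (s : Fin t) → Dual F (W s)
            g s = fn (L (i s)) (js s)

    OA⇒MixedSpread : ∀ {t} (L : (c : Fin k) → Labeling F (V c)) → t ≤ k →
                     IsOAofStrength F V L t → MixedSpread F V t
    OA⇒MixedSpread L t≤k oa τ τ≤t i inc =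
      DirectSum⇒HasDim (V ∘ i) (Realizable⇒DirectSum (StrictlyIncreasing⇒injective inc)
        (Realizable-restrict E (OA⇒Realizable L oa (Extension.increasing E))))
      where
        E : Extension _ i
        E = extend τ≤t t≤k inc

theorem5 : (q : ℕ) → IsPrimePower q → (F : FiniteField q) →
    (n k t : ℕ) → t ≤ k →
    (V : Fin k → Subspace F n) → (L : (i : Fin k) → Labeling F (V i)) →
    IsOAofStrength F V L t ⇔ MixedSpread F V t
theorem5 q _ F n k t t≤k V L = mk⇔ (OA⇒MixedSpread F V L t≤k) (MixedSpread⇒OA F V L)
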